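{- Let $q$ be a prime power and $\mathcal{M}=\mathbb{F}_q\times\mathbb{F}_q^{*}\times\mathbb{F}_q$ with commuting relation $(x_1,y_1,z_1)$ commutes with $(x_2,y_2,z_2)$ iff $x_1y_2-y_1x_2=z_1-z_2$. Then: (1) every abelian subset of $\mathcal{M}$ has cardinality at most $q$; (2) there is no decomposition of $\mathcal{M}$ into fewer than $q(q-1)$ abelian sets; (3) the maximum size of an abelian subset of $\mathcal{M}$ that is not contained in a strictly larger abelian subset is $q$.
   Context: A subset of $\mathcal{M}$ is abelian if any two distinct elements commute. A decomposition of $\mathcal{M}$ into abelian sets is a partition of $\mathcal{M}$ into abelian subsets. -}

module Defs where

open import Level using (0ℓ)
open import Data.Nat using (ℕ; _≤_; _<_; _*_; _∸_)
open import Data.Nat.Primality using (Prime)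
open import Data.Fin using (Fin)
open import Data.Product using (_×_; _,_; ∃; ∃-syntax)
open import Data.List using (List; length; _∷_)
open import Data.List.Membership.Propositional using (_∈_; _∉_)
open import Data.List.Relation.Unary.Unique.Propositional using (Unique)
open import Function.Bundles using (_↔_)
open import Relation.Binary.PropositionalEquality using (_≡_; _≢_)
open import Relation.Nullary using (¬_)
open import Algebra.Structures using (IsCommutativeRing)

IsPrimePower : ℕ → Set
IsPrimePower q = ∃[ p ] ∃[ k ] (Prime p × 1 ≤ k × q ≡ p Data.Nat.^ k)

record Field : Set₁ where
  infixl 6 _+_ _-_
  infixl 7 _·_
  field
    Carrier : Set
    _+_ _·_ : Carrier → Carrier → Carrier
    -_      : Carrier → Carrier
    0# 1#   : Carrier
    isCommutativeRing : IsCommutativeRing _≡_ _+_ _·_ -_ 0# 1#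
    0≢1     : 0# ≢ 1#
    inverse : ∀ x → x ≢ 0# → ∃[ y ] (x · y ≡ 1#)
  _-_ : Carrier → Carrier → Carrier
  x - y = x + (- y)

record FiniteField (q : ℕ) : Set₁ where
  field
    field′ : Field
  open Field field′ public
  field
    enum : Carrier ↔ Fin q

module M-structure {q : ℕ} (F : FiniteField q) where
  open FiniteField F

  -- Elements of F_q × F_q × F_q; membership in 𝓜 = F_q × F_q^* × F_q is InM
  Triple : Set
  Triple = Carrier × Carrier × Carrier

  InM : Triple → Set
  InM (x , y , z) = y ≢ 0#

  Commutes : Triple → Triple → Set
  Commutes (x₁ , y₁ , z₁) (x₂ , y₂ , z₂) = x₁ · y₂ - y₁ · x₂ ≡ z₁ - z₂

  -- A finite subset of 𝓜, represented by a duplicate-free list of elements of 𝓜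
  -- (its cardinality is the length of the list)
  record SubsetM (A : List Triple) : Set where
    field
      unique : Unique A
      inM    : ∀ {a} → a ∈ A → InM a

  IsAbelian : List Triple → Set
  IsAbelian A = ∀ {a b} → a ∈ A → b ∈ A → a ≢ b → Commutes a b

  AbelianSubset : List Triple → Set
  AbelianSubset A = SubsetM A × IsAbelian A

  _⊆_ : List Triple → List Triple → Set
  A ⊆ B = ∀ {a} → a ∈ A → a ∈ B

  MaximalAbelian : List Triple → Set
  MaximalAbelian A = AbelianSubset A ×
    (∀ B → AbelianSubset B → A ⊆ B → B ⊆ A)

  -- A decomposition of 𝓜 into abelian sets: a partition of 𝓜 into
  -- (nonempty, pairwise disjoint) abelian subsets covering 𝓜.
  -- The number of parts is the length of the outer list.
  record Decomposition (P : List (List Triple)) : Set where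
    field
      parts-abelian  : ∀ {A} → A ∈ P → AbelianSubset A
      parts-nonempty : ∀ {A} → A ∈ P → ∃[ a ] (a ∈ A)
      parts-distinct : Unique P
      cover          : ∀ m → InM m → ∃[ A ] (A ∈ P × m ∈ A)
      disjoint       : ∀ {A B m} → A ∈ P → B ∈ P → m ∈ A → m ∈ B → A ≡ B

module Submission where

-- Write c = (x_c, y_c, z_c).  In additive form, c commutes with a iff
-- z_c + y_c·x_a = x_c·y_a + z_a.  If c and c′ have the same x-coordinate
-- and both commute with a and with b, the affine functions
-- p ↦ z_c + y_c·p and p ↦ z_c′ + y_c′·p therefore agree at p = x_a and at
-- p = x_b; when x_a ≠ x_b they coincide, so c = c′.  The involution
-- (x, y, z) ↦ (y, x, −z) preserves commutation and swaps the first two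
-- coordinates, giving the same statement for y.  Distinct commuting
-- elements differ in x or in y (equal x and y force equal z), so on an
-- abelian set with two distinct elements some coordinate projection to
-- 𝔽_q is injective: (1) abelian sets have at most q elements.  Hence
-- (3) every abelian set of size q -- e.g. the diagonal {(x, 1, x)} -- is
-- maximal, and maximal ones have size ≤ q; and (2) a decomposition covers
-- the q·(q − 1)·q elements of 𝓜 by parts of size ≤ q, so it has at least
-- q·(q − 1) parts.

open import Defs
open import Level using (0ℓ)
open import Algebra.Bundles using (CommutativeRing)
open import Algebra.Structures using (IsCommutativeRing)
open import Data.Nat using (ℕ; zero; suc; _≤_; _*_; _∸_; z≤n; >-nonZero⁻¹) renaming (_+_ to _+ℕ_)
import Data.Nat.Properties as ℕ
open import Data.Fin using (Fin; remQuot; punchIn)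
open import Data.Fin.Properties
  using (injective⇒≤; punchIn-injective; punchInᵢ≢i; *↔×; nonZeroIndex)
  renaming (_≟_ to _≟ᶠ_)
open import Data.Product using (_×_; _,_; proj₁; proj₂; ∃-syntax)
open import Data.Product.Properties using (≡-dec)
open import Data.Sum using (_⊎_; inj₁; inj₂)
open import Data.List using (List; []; _∷_; length; lookup; concat; tabulate)
import Data.List.Properties as List
open import Data.List.Relation.Unary.Any using (here; there)
import Data.List.Relation.Unary.All as All
open All using (_∷_)
open import Data.List.Relation.Unary.All.Properties using (¬Any⇒All¬)
open import Data.List.Relation.Unary.AllPairs using (_∷_)
open import Data.List.Relation.Unary.Unique.Propositional using (Unique)
open import Data.List.Relation.Unary.Unique.Propositional.Properties using (tabulate⁺)
open import Data.List.Membership.Propositional using (_∈_)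
open import Data.List.Membership.Propositional.Properties
  using (∈-lookup; ∈-tabulate⁻; ∈-concat⁺′)
import Data.List.Membership.Setoid.Properties as SetoidMembership
import Data.List.Membership.DecPropositional as DecMembership
open import Function.Base using (_∘_)
open import Function.Bundles using (Inverse; Injection)
open import Function.Definitions using (Injective)
open import Function.Properties.Inverse using (Inverse⇒Injection; ↔-sym)
open import Relation.Binary.Definitions using (DecidableEquality)
open import Relation.Binary.PropositionalEquality
open import Relation.Nullary using (yes; no)
open import Relation.Nullary.Decidable using (map′)
open import Relation.Nullary.Negation using (contradiction)

lookup-injective : ∀ {X : Set} {xs : List X} → Unique xs →
  ∀ i j → lookup xs i ≡ lookup xs j → i ≡ j
lookup-injective (_ ∷ _) Fin.zero Fin.zero _ = refl
lookup-injective (x∉xs ∷ _) Fin.zero (Fin.suc j) e =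
  contradiction e (All.lookup x∉xs (∈-lookup j))
lookup-injective (x∉xs ∷ _) (Fin.suc i) Fin.zero e =
  contradiction (sym e) (All.lookup x∉xs (∈-lookup i))
lookup-injective (_ ∷ u) (Fin.suc i) (Fin.suc j) e =
  cong Fin.suc (lookup-injective u i j e)

injectiveOn⇒length≤ : ∀ {X : Set} {n} (xs : List X) → Unique xs → (f : X → Fin n) →
  (∀ {a b} → a ∈ xs → b ∈ xs → f a ≡ f b → a ≡ b) → length xs ≤ n
injectiveOn⇒length≤ xs u f f-inj = injective⇒≤ λ {i} {j} e →
  lookup-injective u i j (f-inj (∈-lookup i) (∈-lookup j) e)

injection⇒≤length : ∀ {X : Set} {m} (ys : List X) (g : Fin m → X) →
  Injective _≡_ _≡_ g → (∀ i → g i ∈ ys) → m ≤ length ys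
injection⇒≤length {X} ys g g-inj g∈ys = injective⇒≤ λ {i} {j} e →
  g-inj (SetoidMembership.index-injective (setoid X) (g∈ys i) (g∈ys j) e)

length-concat≤ : ∀ {X : Set} k (P : List (List X)) →
  (∀ {A} → A ∈ P → length A ≤ k) → length (concat P) ≤ k * length P
length-concat≤ k [] _ = z≤n
length-concat≤ k (A ∷ P) bounded = begin
  length (concat (A ∷ P))       ≡⟨ List.length-++ A ⟩
  length A +ℕ length (concat P) ≤⟨ ℕ.+-mono-≤ (bounded (here refl))
                                              (length-concat≤ k P (bounded ∘ there)) ⟩
  k +ℕ k * length P             ≡⟨ ℕ.*-suc k (length P) ⟨
  k * suc (length P)            ∎
  where open ℕ.≤-Reasoning

module FieldAlgebra (K : Field) where
  open Field K

  commutativeRing : CommutativeRing 0ℓ 0ℓ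
  commutativeRing = record { isCommutativeRing = isCommutativeRing }

  open CommutativeRing commutativeRing
    using (+-identityʳ; -‿inverseʳ; *-assoc; *-comm; *-identityʳ; zeroˡ;
           +-group; +-abelianGroup; ring; commutativeSemiring)
  open import Algebra.Properties.Group +-group using (x∙y⁻¹≈ε⇒x≈y; x≈y⇒x∙y⁻¹≈ε)
  open import Algebra.Properties.Group +-group
    using () renaming (⁻¹-involutive to -‿involutive) public
  open import Algebra.Properties.AbelianGroup +-abelianGroup
    using (⁻¹-anti-homo‿-; ⁻¹-∙-comm) public
  open import Algebra.Properties.Ring ring using (x[y-z]≈xy-xz; [y-z]x≈yx-zx)
  open import Algebra.Solver.Ring.NaturalCoefficients.Default commutativeSemiring
  open ≡-Reasoning

  difference-zero⇒equal : ∀ u v → u - v ≡ 0# → u ≡ v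
  difference-zero⇒equal = x∙y⁻¹≈ε⇒x≈y

  equal⇒difference-zero : ∀ {u v} → u ≡ v → u - v ≡ 0#
  equal⇒difference-zero = x≈y⇒x∙y⁻¹≈ε

  ·-commutator : ∀ x y → x · y - y · x ≡ 0#
  ·-commutator x y = equal⇒difference-zero (*-comm x y)

  -- Adding 0 in the form w − w; both rearrangements below pivot on it.
  add-cancelling : ∀ u w → u ≡ u + (w - w)
  add-cancelling u w = trans (sym (+-identityʳ u)) (cong (u +_) (sym (-‿inverseʳ w)))

  difference⇒sum : ∀ a b c d → a - b ≡ c - d → a + d ≡ c + b
  difference⇒sum a b c d e = begin
    a + d                   ≡⟨ add-cancelling (a + d) b ⟩
    (a + d) + (b - b)       ≡⟨ solve 4 (λ a d b nb → (a :+ d) :+ (b :+ nb) := (a :+ nb) :+ (d :+ b))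
                                 refl a d b (- b) ⟩
    (a - b) + (d + b)       ≡⟨ cong (_+ (d + b)) e ⟩
    (c - d) + (d + b)       ≡⟨ solve 4 (λ c nd d b → (c :+ nd) :+ (d :+ b) := (c :+ b) :+ (d :+ nd))
                                 refl c (- d) d b ⟩
    (c + b) + (d - d)       ≡⟨ add-cancelling (c + b) d ⟨
    c + b                   ∎

  sum⇒difference : ∀ a b c d → a + b ≡ c + d → a - c ≡ d - b
  sum⇒difference a b c d e = begin
    a - c                   ≡⟨ add-cancelling (a - c) b ⟩
    (a - c) + (b - b)       ≡⟨ solve 4 (λ a nc b nb → (a :+ nc) :+ (b :+ nb) := (a :+ b) :+ (nc :+ nb))
                                 refl a (- c) b (- b) ⟩
    (a + b) + (- c + - b)   ≡⟨ cong (_+ (- c + - b)) e ⟩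
    (c + d) + (- c + - b)   ≡⟨ solve 4 (λ c d nc nb → (c :+ d) :+ (nc :+ nb) := (d :+ nb) :+ (c :+ nc))
                                 refl c d (- c) (- b) ⟩
    (d - b) + (c - c)       ≡⟨ add-cancelling (d - b) c ⟨
    d - b                   ∎

  no-zero-divisors : ∀ u v → v ≢ 0# → u · v ≡ 0# → u ≡ 0#
  no-zero-divisors u v v≢0 uv≡0 with inverse v v≢0
  ... | v⁻¹ , vv⁻¹≡1 = begin
    u                ≡⟨ *-identityʳ u ⟨
    u · 1#           ≡⟨ cong (u ·_) vv⁻¹≡1 ⟨
    u · (v · v⁻¹)    ≡⟨ *-assoc u v v⁻¹ ⟨
    (u · v) · v⁻¹    ≡⟨ cong (_· v⁻¹) uv≡0 ⟩
    0# · v⁻¹         ≡⟨ zeroˡ v⁻¹ ⟩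
    0#               ∎

  affine-agreement : ∀ {s t s′ t′ p r} → p ≢ r →
    t + s · p ≡ t′ + s′ · p → t + s · r ≡ t′ + s′ · r → s ≡ s′ × t ≡ t′
  affine-agreement {s} {t} {s′} {t′} {p} {r} p≢r at-p at-r = slopes , intercepts
    where
    gap : ∀ {w} → t + s · w ≡ t′ + s′ · w → t - t′ ≡ (s′ - s) · w
    gap {w} e = trans (sum⇒difference t (s · w) t′ (s′ · w) e) (sym ([y-z]x≈yx-zx w s′ s))

    slope-difference-zero : s′ - s ≡ 0#
    slope-difference-zero = no-zero-divisors (s′ - s) (p - r)
      (p≢r ∘ difference-zero⇒equal p r)
      (trans (x[y-z]≈xy-xz (s′ - s) p r)
             (equal⇒difference-zero (trans (sym (gap at-p)) (gap at-r))))

    slopes : s ≡ s′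
    slopes = sym (difference-zero⇒equal s′ s slope-difference-zero)

    intercepts : t ≡ t′
    intercepts = difference-zero⇒equal t t′
      (trans (gap at-p) (trans (cong (_· p) slope-difference-zero) (zeroˡ p)))

module Commutation {q : ℕ} (F : FiniteField q) where
  open FiniteField F
  open M-structure F
  open FieldAlgebra field′
  open ≡-Reasoning

  xOf yOf : Triple → Carrier
  xOf = proj₁
  yOf = proj₁ ∘ proj₂

  commutes-refl : ∀ c → Commutes c c
  commutes-refl (x , y , z) =
    trans (·-commutator x y) (sym (equal⇒difference-zero {z} refl))

  balanced : ∀ {xc yc zc xa ya za} → Commutes (xc , yc , zc) (xa , ya , za) →
    zc + yc · xa ≡ xc · ya + za
  balanced {xc} {yc} {zc} {xa} {ya} {za} e = sym (difference⇒sum (xc · ya) (yc · xa) zc za e)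

  -- If x_a ≠ x_b, an element commuting with a and b is determined by its
  -- x-coordinate: p ↦ z_c + y_c·p and p ↦ z_c′ + y_c′·p agree at x_a, x_b.
  x-determines : ∀ {a b c c′} → xOf a ≢ xOf b →
    Commutes c a → Commutes c b → Commutes c′ a → Commutes c′ b →
    xOf c ≡ xOf c′ → c ≡ c′
  x-determines {_ , _ , _} {_ , _ , _} {_ , _ , _} {_ , _ , _} xa≢xb ca cb c′a c′b refl
    with affine-agreement xa≢xb (trans (balanced ca) (sym (balanced c′a)))
                                (trans (balanced cb) (sym (balanced c′b)))
  ... | refl , refl = refl

  swap : Triple → Triple
  swap (x , y , z) = y , x , - z

  swap-commutes : ∀ {c a} → Commutes c a → Commutes (swap c) (swap a)
  swap-commutes {xc , yc , zc} {xa , ya , za} e = begin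
    yc · xa - xc · ya        ≡⟨ ⁻¹-anti-homo‿- (xc · ya) (yc · xa) ⟨
    - (xc · ya - yc · xa)    ≡⟨ cong -_ e ⟩
    - (zc - za)              ≡⟨ ⁻¹-∙-comm zc (- za) ⟨
    - zc - - za              ∎

  swap-involutive : ∀ c → swap (swap c) ≡ c
  swap-involutive (x , y , z) = cong (λ w → x , y , w) (-‿involutive z)

  swap-injective : ∀ {c c′} → swap c ≡ swap c′ → c ≡ c′
  swap-injective {c} {c′} e =
    trans (sym (swap-involutive c)) (trans (cong swap e) (swap-involutive c′))

  y-determines : ∀ {a b c c′} → yOf a ≢ yOf b →
    Commutes c a → Commutes c b → Commutes c′ a → Commutes c′ b →
    yOf c ≡ yOf c′ → c ≡ c′
  y-determines {_ , _ , _} {_ , _ , _} {_ , _ , _} {_ , _ , _} ya≢yb ca cb c′a c′b yc≡yc′ =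
    swap-injective (x-determines ya≢yb (swap-commutes ca) (swap-commutes cb)
                                       (swap-commutes c′a) (swap-commutes c′b) yc≡yc′)

  same-xy⇒equal : ∀ {a b} → Commutes a b → xOf a ≡ xOf b → yOf a ≡ yOf b → a ≡ b
  same-xy⇒equal {x , y , za} {.x , .y , zb} e refl refl =
    cong (λ z → x , y , z) (difference-zero⇒equal za zb (trans (sym e) (·-commutator x y)))

module AbelianSubsets {q : ℕ} (F : FiniteField q) where
  open FiniteField F
  open M-structure F
  open Commutation F
  open Inverse enum using (to; from)
  open IsCommutativeRing isCommutativeRing using (*-identityˡ; *-identityʳ)

  to-injective : Injective _≡_ _≡_ to
  to-injective = Injection.injective (Inverse⇒Injection enum)

  from-injective : Injective _≡_ _≡_ from
  from-injective = Injection.injective (Inverse⇒Injection (↔-sym enum))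

  _≟_ : DecidableEquality Carrier
  x ≟ y = map′ to-injective (cong to) (to x ≟ᶠ to y)

  _≟ᵀ_ : DecidableEquality Triple
  _≟ᵀ_ = ≡-dec _≟_ (≡-dec _≟_ _≟_)

  open DecMembership _≟ᵀ_ using (_∈?_)

  1≤q : 1 ≤ q
  1≤q = >-nonZero⁻¹ q {{nonZeroIndex (to 0#)}}

  -- In an abelian set any two elements commute, equal or not.
  commute-within : ∀ {A} → IsAbelian A → ∀ {a b} → a ∈ A → b ∈ A → Commutes a b
  commute-within abelian {a} {b} a∈A b∈A with a ≟ᵀ b
  ... | yes refl = commutes-refl a
  ... | no a≢b = abelian a∈A b∈A a≢b

  separated : ∀ {a b} → Commutes a b → a ≢ b → xOf a ≢ xOf b ⊎ yOf a ≢ yOf b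
  separated {a} {b} ab a≢b with xOf a ≟ xOf b | yOf a ≟ yOf b
  ... | no xa≢xb  | _         = inj₁ xa≢xb
  ... | yes _     | no ya≢yb  = inj₂ ya≢yb
  ... | yes xa≡xb | yes ya≡yb = contradiction (same-xy⇒equal ab xa≡xb ya≡yb) a≢b

  -- Two distinct
  -- members a, b differ in some coordinate, and that coordinate is
  -- injective on the members (all of which commute with a and b).
  abelian-bound : ∀ A → AbelianSubset A → length A ≤ q
  abelian-bound [] _ = z≤n
  abelian-bound (_ ∷ []) _ = 1≤q
  abelian-bound A@(a ∷ b ∷ _) (subset , abelian) = bound-by (separated (comm a∈A b∈A) a≢b)
    where
    unique : Unique A
    unique = SubsetM.unique subset

    comm : ∀ {c d} → c ∈ A → d ∈ A → Commutes c d
    comm = commute-within abelian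

    a∈A : a ∈ A
    a∈A = here refl

    b∈A : b ∈ A
    b∈A = there (here refl)

    a≢b : a ≢ b
    a≢b with unique
    ... | (a≢b ∷ _) ∷ _ = a≢b

    bound-by : xOf a ≢ xOf b ⊎ yOf a ≢ yOf b → length A ≤ q
    bound-by (inj₁ xa≢xb) = injectiveOn⇒length≤ A unique (to ∘ xOf) λ c∈A c′∈A e →
      x-determines xa≢xb (comm c∈A a∈A) (comm c∈A b∈A) (comm c′∈A a∈A) (comm c′∈A b∈A)
                   (to-injective e)
    bound-by (inj₂ ya≢yb) = injectiveOn⇒length≤ A unique (to ∘ yOf) λ c∈A c′∈A e →
      y-determines ya≢yb (comm c∈A a∈A) (comm c∈A b∈A) (comm c′∈A a∈A) (comm c′∈A b∈A)
                   (to-injective e)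

  abelian-⊆ : ∀ {A B} → AbelianSubset B → Unique A → A ⊆ B → AbelianSubset A
  abelian-⊆ (subset , abelian) unique A⊆B =
    record { unique = unique ; inM = λ a∈A → SubsetM.inM subset (A⊆B a∈A) } ,
    λ a∈A b∈A → abelian (A⊆B a∈A) (A⊆B b∈A)

  -- By part (1), an abelian subset with q elements has no proper abelian
  -- extension: adding a new element would give q + 1 elements.
  size-q⇒maximal : ∀ A → AbelianSubset A → length A ≡ q → MaximalAbelian A
  size-q⇒maximal A abelianA |A|≡q = abelianA , no-extension
    where
    no-extension : ∀ B → AbelianSubset B → A ⊆ B → B ⊆ A
    no-extension B abelianB A⊆B {b} b∈B with b ∈? A
    ... | yes b∈A = b∈A
    ... | no b∉A = contradiction (abelian-bound (b ∷ A) extended) (ℕ.<-irrefl |A|≡q)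
      where
      b∷A⊆B : (b ∷ A) ⊆ B
      b∷A⊆B (here refl) = b∈B
      b∷A⊆B (there a∈A) = A⊆B a∈A

      extended : AbelianSubset (b ∷ A)
      extended = abelian-⊆ abelianB (¬Any⇒All¬ A b∉A ∷ SubsetM.unique (proj₁ abelianA)) b∷A⊆B

  diagonal : List Triple
  diagonal = tabulate (λ i → from i , 1# , from i)

  diagonal-length : length diagonal ≡ q
  diagonal-length = List.length-tabulate _

  diagonal-abelian : AbelianSubset diagonal
  diagonal-abelian =
    record { unique = tabulate⁺ (from-injective ∘ cong xOf) ; inM = in-M } ,
    λ c∈ d∈ _ → commuting c∈ d∈
    where
    diagonal-form : ∀ {c} → c ∈ diagonal → ∃[ x ] c ≡ (x , 1# , x)
    diagonal-form c∈ with ∈-tabulate⁻ c∈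
    ... | i , refl = from i , refl

    in-M : ∀ {c} → c ∈ diagonal → InM c
    in-M c∈ with diagonal-form c∈
    ... | _ , refl = λ 1≡0 → 0≢1 (sym 1≡0)

    -- x·1 − 1·x′ = x − x′
    commuting : ∀ {c d} → c ∈ diagonal → d ∈ diagonal → Commutes c d
    commuting c∈ d∈ with diagonal-form c∈ | diagonal-form d∈
    ... | x , refl | x′ , refl = cong₂ _-_ (*-identityʳ x) (*-identityˡ x′)

module Enumeration {n : ℕ} (F : FiniteField (suc n)) where
  open FiniteField F
  open M-structure F
  open Commutation F using (xOf; yOf)
  open AbelianSubsets F using (abelian-bound; to-injective; from-injective)
  open Inverse enum using (to; from; strictlyInverseˡ)

  q : ℕ
  q = suc n

  -- The n nonzero elements, enumerated by skipping the index of 0.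
  nonzero : Fin n → Carrier
  nonzero j = from (punchIn (to 0#) j)

  nonzero-≢0 : ∀ j → nonzero j ≢ 0#
  nonzero-≢0 j e = punchInᵢ≢i (to 0#) j (trans (sym (strictlyInverseˡ _)) (cong to e))

  nonzero-injective : Injective _≡_ _≡_ nonzero
  nonzero-injective = punchIn-injective (to 0#) _ _ ∘ from-injective

  remQuot-injective : ∀ {a} b → Injective _≡_ _≡_ (remQuot {a} b)
  remQuot-injective b = Injection.injective (Inverse⇒Injection *↔×)

  -- Reading k as mixed-radix digits (i, j, l) gives the element
  -- (x_i, i-th nonzero element, x_l) of 𝓜; distinct k give distinct elements.
  element : Fin (q * (n * q)) → Triple
  element k = let (i , jl) = remQuot (n * q) k
                  (j , l) = remQuot q jl
              in from i , nonzero j , from l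

  element-injective : Injective _≡_ _≡_ element
  element-injective e = remQuot-injective (n * q)
    (cong₂ _,_ (from-injective (cong xOf e))
               (remQuot-injective q (cong₂ _,_ (nonzero-injective (cong yOf e))
                                                (from-injective (cong (proj₂ ∘ proj₂) e)))))

  element-inM : ∀ k → InM (element k)
  element-inM k = nonzero-≢0 _

  -- Part (2) for q ≥ 1: the parts, each of size ≤ q by part (1), cover
  -- the q·((q − 1)·q) elements of 𝓜.
  covering-bound : ∀ P → Decomposition P → q * n ≤ length P
  covering-bound P decomposition =
    subst (_≤ length P) (ℕ.*-comm n q) (ℕ.*-cancelˡ-≤ q (begin
      q * (n * q)        ≤⟨ injection⇒≤length (concat P) element element-injective covered ⟩
      length (concat P)  ≤⟨ length-concat≤ q P (λ A∈P → abelian-bound _ (parts-abelian A∈P)) ⟩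
      q * length P       ∎))
    where
    open Decomposition decomposition
    open ℕ.≤-Reasoning

    covered : ∀ k → element k ∈ concat P
    covered k with cover (element k) (element-inM k)
    ... | _ , A∈P , k∈A = ∈-concat⁺′ k∈A A∈P

decomposition-bound : ∀ {q} (F : FiniteField q) → let open M-structure F in
  ∀ P → Decomposition P → q * (q ∸ 1) ≤ length P
decomposition-bound {zero} _ _ _ = z≤n
decomposition-bound {suc n} F = Enumeration.covering-bound F

-- Theorem 6.6.  The argument works over every finite field.

theorem6p6 : (q : ℕ) → IsPrimePower q → (F : FiniteField q) →
    let open M-structure F in
    (∀ A → AbelianSubset A → length A ≤ q)
    × (∀ P → Decomposition P → q * (q ∸ 1) ≤ length P)
    × ((∃[ A ] (MaximalAbelian A × length A ≡ q))
       × (∀ A → MaximalAbelian A → length A ≤ q))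
theorem6p6 q _ F =
  abelian-bound ,
  decomposition-bound F ,
  (diagonal , size-q⇒maximal diagonal diagonal-abelian diagonal-length , diagonal-length) ,
  (λ A maximal → abelian-bound A (proj₁ maximal))
  where open AbelianSubsets F
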